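{- Let $G=(V,E)$ be a simple, weakly connected directed graph with at least one Eulerian trail, with fixed source $v_0$, let $T^u$ be its uncompressed state tree, and let $s$ be a state of $T^u$. Then $s$ is branching if and only if the last node on $P_s$ has at least two out-edges in $G'_s$ that are not crossings in $G'_s$.
   Context: An Eulerian trail uses every edge exactly once. Source $v_0$: the unique node with $\mathrm{outdeg}(v)=\mathrm{indeg}(v)+1$ if it exists, otherwise an arbitrary fixed node. The uncompressed state tree $T^u$ is the rooted tree whose nodes (states) are the prefixes of Eulerian trails of $G$ starting at $v_0$, the root being the empty prefix, with a transition from $s_1$ to $s_2$ if the prefix $P_{s_2}$ is obtained from $P_{s_1}$ by appending one edge. The last node on $P_s$ is $v_0$ if $P_s$ is empty and otherwise the head of its last edge. The remaining graph $G'_s$ is obtained from $G$ by deleting the edges of $P_s$ and then removing isolated nodes. A state is branching if it has at least two children. A crossing in a directed graph is an edge whose two endpoints lie in different strongly connected components of that graph. -}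

module Defs where

open import Data.Nat using (ℕ; suc; _+_)
open import Data.Fin using (Fin) renaming (_≟_ to _≟ᶠ_)
open import Data.Product using (Σ; ∃; _×_; _,_; proj₁; proj₂)
open import Data.Product.Properties using (≡-dec)
open import Data.List using (List; []; _∷_; _++_; [_]; length; filter)
open import Data.List.Membership.Propositional using (_∈_)
import Data.List.Membership.DecPropositional as DecMem
open import Data.List.Relation.Unary.All using (All)
open import Data.List.Relation.Unary.Unique.Propositional using (Unique)
open import Data.List.Relation.Binary.Permutation.Propositional using (_↭_)
open import Data.Unit using (⊤)
open import Relation.Nullary using (¬_; ¬?)
open import Relation.Binary.PropositionalEquality using (_≡_; _≢_)

Edge : ℕ → Set
Edge n = Fin n × Fin n

tail head : ∀ {n} → Edge n → Fin n
tail = proj₁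
head = proj₂

Simple : ∀ {n} → List (Edge n) → Set
Simple E = Unique E × All (λ e → tail e ≢ head e) E

data Reach {n} (E : List (Edge n)) : Fin n → Fin n → Set where
  here : ∀ {u} → Reach E u u
  step : ∀ {u w v} → (u , w) ∈ E → Reach E w v → Reach E u v

data WReach {n} (E : List (Edge n)) : Fin n → Fin n → Set where
  here : ∀ {u} → WReach E u u
  fwd  : ∀ {u w v} → (u , w) ∈ E → WReach E w v → WReach E u v
  bwd  : ∀ {u w v} → (w , u) ∈ E → WReach E w v → WReach E u v

WeaklyConnected : ∀ {n} → List (Edge n) → Set
WeaklyConnected E = ∀ u v → WReach E u v

outdeg indeg : ∀ {n} → List (Edge n) → Fin n → ℕ
outdeg E v = length (filter (λ e → tail e ≟ᶠ v) E)
indeg  E v = length (filter (λ e → head e ≟ᶠ v) E)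

WalkFrom : ∀ {n} → Fin n → List (Edge n) → Set
WalkFrom v [] = ⊤
WalkFrom v (e ∷ es) = tail e ≡ v × WalkFrom (head e) es

EulerianTrailFrom : ∀ {n} → List (Edge n) → Fin n → List (Edge n) → Set
EulerianTrailFrom E v ts = WalkFrom v ts × (ts ↭ E)

HasEulerianTrail : ∀ {n} → List (Edge n) → Set
HasEulerianTrail E = ∃ λ v → ∃ λ ts → EulerianTrailFrom E v ts

IsSource : ∀ {n} → List (Edge n) → Fin n → Set
IsSource E v0 =
  (∃ λ v → outdeg E v ≡ indeg E v + 1) → outdeg E v0 ≡ indeg E v0 + 1

-- States of the uncompressed state tree: prefixes of Eulerian trails from v0.
State : ∀ {n} → List (Edge n) → Fin n → List (Edge n) → Set
State E v0 P = ∃ λ ts → EulerianTrailFrom E v0 ts × ∃ λ rest → ts ≡ P ++ rest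

-- Children of state P are the states P ++ [ e ]; distinct children
-- correspond to distinct appended edges.
Branching : ∀ {n} → List (Edge n) → Fin n → List (Edge n) → Set
Branching E v0 P = ∃ λ e₁ → ∃ λ e₂ → e₁ ≢ e₂ ×
  State E v0 (P ++ [ e₁ ]) × State E v0 (P ++ [ e₂ ])

lastNode : ∀ {n} → Fin n → List (Edge n) → Fin n
lastNode v [] = v
lastNode v (e ∷ es) = lastNode (head e) es

-- Edge set of the remaining graph G'_s: edges of E not in P.
-- (Isolated nodes are removed; they carry no edges, so they do not affect
-- strong components of edge endpoints nor out-edges.)
remaining : ∀ {n} → List (Edge n) → List (Edge n) → List (Edge n)
remaining {n} E P = filter (λ e → ¬? (e ∈? P)) E
  where open DecMem (≡-dec (_≟ᶠ_ {n}) (_≟ᶠ_ {n})) using (_∈?_)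

SameSCC : ∀ {n} → List (Edge n) → Fin n → Fin n → Set
SameSCC E u v = Reach E u v × Reach E v u

Crossing : ∀ {n} → List (Edge n) → Edge n → Set
Crossing E e = e ∈ E × ¬ SameSCC E (tail e) (head e)

TwoNonCrossingOut : ∀ {n} → List (Edge n) → Fin n → Set
TwoNonCrossingOut E x = ∃ λ e₁ → ∃ λ e₂ → e₁ ≢ e₂ ×
  (e₁ ∈ E × tail e₁ ≡ x × ¬ Crossing E e₁) ×
  (e₂ ∈ E × tail e₂ ≡ x × ¬ Crossing E e₂)

{-# OPTIONS --safe #-}
-- Continuing a state P means following an Eulerian trail, from x = lastNode v0 P, of the
-- remaining graph. If such a trail starts with e while another out-edge f of x remains, it
-- must come back to x to take f, so e lies on a cycle and is not a crossing. Conversely, if e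
-- is not a crossing then head e reaches x; cutting the trail from x at e into a closed walk A
-- and a walk B from head e, the nodes of B can only be left along A, so A and B share a node,
-- and splicing A (rotated to start there) into B yields a trail starting with e.
module Submission where

open import Defs
open import Data.Nat using (ℕ)
open import Data.Fin using (Fin) renaming (_≟_ to _≟ᶠ_)
open import Data.List using (List; []; _∷_; _++_; [_])
open import Data.List.Properties using (++-assoc)
open import Data.List.Membership.Propositional using (_∈_; find; lose)
open import Data.List.Membership.Propositional.Properties
  using (∈-++⁺ʳ; ∈-++⁻; ∈-∃++; ∈-filter⁻; ∈-filter⁺)
open import Data.List.Membership.DecPropositional using () renaming (_∈?_ to ∈?)
open import Data.List.Relation.Binary.Disjoint.Propositional using (Disjoint)
open import Data.List.Relation.Binary.Subset.Propositional using (_⊆_)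
open import Data.List.Relation.Binary.Permutation.Propositional
  using (_↭_; prep; ↭-refl; ↭-sym; ↭-trans; ↭⇒↭ₛ)
open import Data.List.Relation.Binary.Permutation.Propositional.Properties
  using (∈-resp-↭; ++⁺ˡ; ++⁺ʳ; ++-comm; shift; shifts; drop-∷)
import Data.List.Relation.Binary.Permutation.Setoid.Properties as ↭ₛ
open import Data.List.Relation.Unary.Any using (Any; here; there; any?)
open import Data.List.Relation.Unary.All using (lookup)
open import Data.List.Relation.Unary.AllPairs using (_∷_)
open import Data.List.Relation.Unary.Unique.Propositional using (Unique)
open import Data.Product using (∃; ∃₂; _×_; _,_; proj₁; proj₂)
open import Data.Sum using (inj₁; inj₂)
open import Data.Unit using (tt)
open import Function using (_∘_)
open import Function.Bundles using (_⇔_; mk⇔; Equivalence)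
open import Level using (Level)
open import Relation.Nullary using (¬_; contradiction)
open import Relation.Nullary.Decidable using (decidable-stable)
open import Relation.Binary.PropositionalEquality
  using (_≡_; _≢_; refl; sym; trans; subst; cong; setoid)

module _ {a : Level} {A : Set a} where

  Unique-resp-↭ : ∀ {xs ys : List A} → xs ↭ ys → Unique xs → Unique ys
  Unique-resp-↭ p = ↭ₛ.Unique-resp-↭ (setoid A) (↭⇒↭ₛ p)

  Unique-++⇒Disjoint : ∀ (xs : List A) {ys} → Unique (xs ++ ys) → Disjoint xs ys
  Unique-++⇒Disjoint (x ∷ xs) (x∉ ∷ _) (here refl , v∈ys) = lookup x∉ (∈-++⁺ʳ xs v∈ys) refl
  Unique-++⇒Disjoint (x ∷ xs) (_ ∷ u) (there v∈xs , v∈ys) = Unique-++⇒Disjoint xs u (v∈xs , v∈ys)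

  ↭-cancelˡ : ∀ (xs : List A) {ys zs} → xs ++ ys ↭ xs ++ zs → ys ↭ zs
  ↭-cancelˡ []       p = p
  ↭-cancelˡ (x ∷ xs) p = ↭-cancelˡ xs (drop-∷ p)

module _ {n : ℕ} where

  lastNode-++ : ∀ (v : Fin n) xs ys → lastNode v (xs ++ ys) ≡ lastNode (lastNode v xs) ys
  lastNode-++ v []       ys = refl
  lastNode-++ v (e ∷ xs) ys = lastNode-++ (head e) xs ys

  WalkFrom-++⁻ : ∀ (v : Fin n) xs {ys} → WalkFrom v (xs ++ ys) →
                 WalkFrom v xs × WalkFrom (lastNode v xs) ys
  WalkFrom-++⁻ v []       walk            = tt , walk
  WalkFrom-++⁻ v (e ∷ xs) (tail≡v , walk) =
    let walk₁ , walk₂ = WalkFrom-++⁻ (head e) xs walk in (tail≡v , walk₁) , walk₂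

  WalkFrom-++⁺ : ∀ {v u : Fin n} xs {ys} → WalkFrom v xs → lastNode v xs ≡ u → WalkFrom u ys →
                 WalkFrom v (xs ++ ys)
  WalkFrom-++⁺ []       _                 refl walk₂ = walk₂
  WalkFrom-++⁺ (e ∷ xs) (tail≡v , walk₁) end  walk₂ = tail≡v , WalkFrom-++⁺ xs walk₁ end walk₂

  visited : Fin n → List (Edge n) → List (Fin n)
  visited v []       = [ v ]
  visited v (e ∷ es) = v ∷ visited (head e) es

  start-visited : ∀ (v : Fin n) es → v ∈ visited v es
  start-visited v []      = here refl
  start-visited v (_ ∷ _) = here refl

  visited-split : ∀ {v w : Fin n} es → w ∈ visited v es →
                  ∃₂ λ es₁ es₂ → es ≡ es₁ ++ es₂ × lastNode v es₁ ≡ w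
  visited-split []       (here refl) = [] , [] , refl , refl
  visited-split (e ∷ es) (here refl) = [] , e ∷ es , refl , refl
  visited-split (e ∷ es) (there w∈) =
    let es₁ , es₂ , eq , end = visited-split es w∈ in e ∷ es₁ , es₂ , cong (e ∷_) eq , end

  endpoints-visited : ∀ {v : Fin n} {es f} → WalkFrom v es → f ∈ es →
                      tail f ∈ visited v es × head f ∈ visited v es
  endpoints-visited {es = e ∷ es} (refl , _)    (here refl) = here refl , there (start-visited (head e) es)
  endpoints-visited {es = e ∷ es} (_    , walk) (there f∈)  =
    let tail∈ , head∈ = endpoints-visited walk f∈ in there tail∈ , there head∈

  Reach-mono : ∀ {G H : List (Edge n)} {u v} → G ⊆ H → Reach G u v → Reach H u v
  Reach-mono G⊆H here          = here
  Reach-mono G⊆H (step e∈ rch) = step (G⊆H e∈) (Reach-mono G⊆H rch)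

  Reach-preserves : ∀ {G : List (Edge n)} (S : Fin n → Set) →
                    (∀ {e} → e ∈ G → S (tail e) → S (head e)) → ∀ {u v} → Reach G u v → S u → S v
  Reach-preserves S closed here          Su = Su
  Reach-preserves S closed (step e∈ rch) Su = Reach-preserves S closed rch (closed e∈ Su)

  WalkFrom⇒Reach-tail : ∀ {v : Fin n} {es f} → WalkFrom v es → f ∈ es → Reach es v (tail f)
  WalkFrom⇒Reach-tail {es = e ∷ es} (refl , _)    (here refl) = here
  WalkFrom⇒Reach-tail {es = e ∷ es} (refl , walk) (there f∈)  =
    step (here refl) (Reach-mono there (WalkFrom⇒Reach-tail walk f∈))

  rotate : ∀ {x w : Fin n} A → WalkFrom x A → lastNode x A ≡ x → w ∈ visited x A →
           ∃ λ A′ → WalkFrom w A′ × lastNode w A′ ≡ w × A′ ↭ A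
  rotate {x} A walk closed w∈A with visited-split A w∈A
  ... | A₁ , A₂ , refl , refl =
    A₂ ++ A₁ , WalkFrom-++⁺ A₂ walk₂ end₂ walk₁ , end , ++-comm A₂ A₁
    where
    walk₁ = proj₁ (WalkFrom-++⁻ x A₁ walk)
    walk₂ = proj₂ (WalkFrom-++⁻ x A₁ walk)
    end₂ : lastNode (lastNode x A₁) A₂ ≡ x
    end₂ = trans (sym (lastNode-++ x A₁ A₂)) closed
    end : lastNode (lastNode x A₁) (A₂ ++ A₁) ≡ lastNode x A₁
    end = trans (lastNode-++ _ A₂ A₁) (cong (λ z → lastNode z A₁) end₂)

  insert : ∀ {y w : Fin n} B C → WalkFrom y B → w ∈ visited y B → WalkFrom w C → lastNode w C ≡ w →
           ∃ λ T → WalkFrom y T × T ↭ C ++ B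
  insert {y} B C walkB w∈B walkC closedC with visited-split B w∈B
  ... | B₁ , B₂ , refl , refl =
    let walk₁ , walk₂ = WalkFrom-++⁻ y B₁ walkB
    in B₁ ++ C ++ B₂ , WalkFrom-++⁺ B₁ walk₁ refl (WalkFrom-++⁺ C walkC closedC walk₂) , shifts B₁ C

  -- Meeting is decidable, so refuting its negation suffices: the nodes of B can only be left
  -- along edges of A, whose tails are nodes of A.
  returning-walk-meets : ∀ {x : Fin n} {e} A B → WalkFrom x A → tail e ≡ x → WalkFrom (head e) B →
                         ¬ ¬ Reach (A ++ e ∷ B) (head e) x →
                         Any (_∈ visited x A) (visited (head e) B)
  returning-walk-meets {x} {e} A B walkA tail≡x walkB ¬¬reach =
    decidable-stable (any? (λ w → ∈? _≟ᶠ_ w (visited x A)) (visited (head e) B)) λ apart →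
      ¬¬reach λ reach →
        apart (lose (Reach-preserves S (closed apart) reach (start-visited (head e) B)) (start-visited x A))
    where
    S : Fin n → Set
    S = _∈ visited (head e) B
    closed : ¬ Any (_∈ visited x A) (visited (head e) B) →
             ∀ {f} → f ∈ A ++ e ∷ B → S (tail f) → S (head f)
    closed apart f∈ tail∈B with ∈-++⁻ A f∈
    ... | inj₁ f∈A         = contradiction (lose tail∈B (proj₁ (endpoints-visited walkA f∈A))) apart
    ... | inj₂ (here refl) =
      contradiction (lose tail∈B (subst (_∈ visited x A) (sym tail≡x) (start-visited x A))) apart
    ... | inj₂ (there f∈B) = proj₂ (endpoints-visited walkB f∈B)

  splice : ∀ {x : Fin n} {e} ts → WalkFrom x ts → e ∈ ts → tail e ≡ x → ¬ ¬ Reach ts (head e) x →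
           ∃ λ T → WalkFrom (head e) T × e ∷ T ↭ ts
  splice {x} {e} ts walk e∈ts tail≡x ¬¬reach with ∈-∃++ e∈ts
  ... | A , B , refl =
    let walkA , (tail≡end , walkB) = WalkFrom-++⁻ x A walk
        w , w∈B , w∈A = find (returning-walk-meets A B walkA tail≡x walkB ¬¬reach)
        A′ , walkA′ , closedA′ , A′↭A = rotate A walkA (trans (sym tail≡end) tail≡x) w∈A
        T , walkT , T↭A′B = insert B A′ walkB w∈B walkA′ closedA′
    in T , walkT , ↭-trans (prep e (↭-trans T↭A′B (++⁺ʳ B A′↭A))) (↭-sym (shift e A B))

  FirstEdge : List (Edge n) → Fin n → Edge n → Set
  FirstEdge G x e = ∃ λ T → EulerianTrailFrom G x (e ∷ T)

  NonCrossingOut : List (Edge n) → Fin n → Edge n → Set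
  NonCrossingOut G x e = e ∈ G × tail e ≡ x × ¬ Crossing G e

  FirstEdge⇒out : ∀ {G x e} → FirstEdge G x e → e ∈ G × tail e ≡ x
  FirstEdge⇒out (_ , (walk , e∷T↭G)) = ∈-resp-↭ e∷T↭G (here refl) , proj₁ walk

  FirstEdge⇒NonCrossingOut : ∀ {G x e f} → FirstEdge G x e → f ∈ G × tail f ≡ x → f ≢ e →
                             NonCrossingOut G x e
  FirstEdge⇒NonCrossingOut {G} {e = e} {f} (T , ((tail≡x , walkT) , e∷T↭G)) (f∈G , tailf≡x) f≢e =
    ∈-resp-↭ e∷T↭G (here refl) , tail≡x , λ (e∈G , apart) → apart (step e∈G here , back)
    where
    f∈T : f ∈ T
    f∈T with ∈-resp-↭ (↭-sym e∷T↭G) f∈G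
    ... | here f≡e = contradiction f≡e f≢e
    ... | there f∈ = f∈
    back : Reach G (head e) (tail e)
    back = subst (Reach G (head e)) (trans tailf≡x (sym tail≡x))
                 (Reach-mono (∈-resp-↭ e∷T↭G ∘ there) (WalkFrom⇒Reach-tail walkT f∈T))

  NonCrossingOut⇒FirstEdge : ∀ {G x ts e} → EulerianTrailFrom G x ts → NonCrossingOut G x e →
                             FirstEdge G x e
  NonCrossingOut⇒FirstEdge {x = x} {ts} {e} (walk , ts↭G) (e∈G , tail≡x , noncrossing) =
    let T , walkT , e∷T↭ts = splice ts walk (∈-resp-↭ (↭-sym ts↭G) e∈G) tail≡x ¬¬reach
    in T , ((tail≡x , walkT) , ↭-trans e∷T↭ts ts↭G)
    where
    ¬¬reach : ¬ ¬ Reach ts (head e) x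
    ¬¬reach unreachable = noncrossing (e∈G , λ (_ , back) →
      unreachable (subst (Reach ts (head e)) tail≡x (Reach-mono (∈-resp-↭ (↭-sym ts↭G)) back)))

  SameSCC-mono : ∀ {G H : List (Edge n)} {u v} → G ⊆ H → SameSCC G u v → SameSCC H u v
  SameSCC-mono G⊆H (forth , back) = Reach-mono G⊆H forth , Reach-mono G⊆H back

  NonCrossingOut-cong : ∀ {G H x e} → G ⊆ H → H ⊆ G → NonCrossingOut G x e → NonCrossingOut H x e
  NonCrossingOut-cong G⊆H H⊆G (e∈G , tail≡x , noncrossing) =
    G⊆H e∈G , tail≡x , λ (e∈H , apart) → noncrossing (H⊆G e∈H , apart ∘ SameSCC-mono G⊆H)

module _ {n : ℕ} {E : List (Edge n)} {P Q : List (Edge n)} (P++Q↭E : P ++ Q ↭ E) where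

  remaining⊆ : remaining E P ⊆ Q
  remaining⊆ f∈R with ∈-filter⁻ _ {xs = E} f∈R
  ... | f∈E , f∉P with ∈-++⁻ P (∈-resp-↭ (↭-sym P++Q↭E) f∈E)
  ...   | inj₁ f∈P = contradiction f∈P f∉P
  ...   | inj₂ f∈Q = f∈Q

  ⊆remaining : Unique E → Q ⊆ remaining E P
  ⊆remaining unique f∈Q =
    ∈-filter⁺ _ {xs = E} (∈-resp-↭ P++Q↭E (∈-++⁺ʳ P f∈Q))
      (λ f∈P → Unique-++⇒Disjoint P (Unique-resp-↭ (↭-sym P++Q↭E) unique) (f∈P , f∈Q))

module _ {n : ℕ} {E : List (Edge n)} {v0 : Fin n} {P rest : List (Edge n)}
         (walk : WalkFrom v0 (P ++ rest)) (P++rest↭E : P ++ rest ↭ E) where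

  State-snoc⇔FirstEdge : ∀ {e} → State E v0 (P ++ [ e ]) ⇔ FirstEdge rest (lastNode v0 P) e
  State-snoc⇔FirstEdge {e} = mk⇔ to from
    where
    to : State E v0 (P ++ [ e ]) → FirstEdge rest (lastNode v0 P) e
    to (_ , (walk′ , perm′) , T , refl) =
      T , proj₂ (WalkFrom-++⁻ v0 P (subst (WalkFrom v0) (++-assoc P [ e ] T) walk′)) ,
      ↭-cancelˡ P (↭-trans (subst (_↭ E) (++-assoc P [ e ] T) perm′) (↭-sym P++rest↭E))
    from : FirstEdge rest (lastNode v0 P) e → State E v0 (P ++ [ e ])
    from (T , walkT , e∷T↭rest) =
      P ++ e ∷ T ,
      (WalkFrom-++⁺ P (proj₁ (WalkFrom-++⁻ v0 P walk)) refl walkT , ↭-trans (++⁺ˡ P e∷T↭rest) P++rest↭E) ,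
      T , sym (++-assoc P [ e ] T)

mainTheorem4 : (n : ℕ) (E : List (Edge n)) (v0 : Fin n) →
    Simple E → WeaklyConnected E → HasEulerianTrail E → IsSource E v0 →
    (P : List (Edge n)) → State E v0 P →
    Branching E v0 P ⇔ TwoNonCrossingOut (remaining E P) (lastNode v0 P)
mainTheorem4 n E v0 (unique , _) _ _ _ P (_ , (walk , P++rest↭E) , rest , refl) =
  mk⇔ (λ (e₁ , e₂ , e₁≢e₂ , s₁ , s₂) → e₁ , e₂ , e₁≢e₂ , nonCrossingOut s₁ s₂ (e₁≢e₂ ∘ sym) ,
                                                          nonCrossingOut s₂ s₁ e₁≢e₂)
      (λ (e₁ , e₂ , e₁≢e₂ , o₁ , o₂) → e₁ , e₂ , e₁≢e₂ , extend o₁ , extend o₂)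
  where
  x = lastNode v0 P
  R = remaining E P
  next : ∀ {e} → State E v0 (P ++ [ e ]) ⇔ FirstEdge rest x e
  next = State-snoc⇔FirstEdge walk P++rest↭E
  R⊆rest = remaining⊆ P++rest↭E
  rest⊆R = ⊆remaining P++rest↭E unique

  nonCrossingOut : ∀ {e f} → State E v0 (P ++ [ e ]) → State E v0 (P ++ [ f ]) → f ≢ e →
                   NonCrossingOut R x e
  nonCrossingOut se sf f≢e =
    NonCrossingOut-cong rest⊆R R⊆rest
      (FirstEdge⇒NonCrossingOut (Equivalence.to next se) (FirstEdge⇒out (Equivalence.to next sf)) f≢e)

  extend : ∀ {e} → NonCrossingOut R x e → State E v0 (P ++ [ e ])
  extend o = Equivalence.from next
    (NonCrossingOut⇒FirstEdge (proj₂ (WalkFrom-++⁻ v0 P walk) , ↭-refl) (NonCrossingOut-cong R⊆rest rest⊆R o))
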